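{- For all integers $j\geq1$ and $k\geq1$, \[ \pi_5(c(2j-1,k))\geq j+\left\lfloor\frac{5k-5}{2}\right\rfloor,\qquad \pi_5(c(2j,k))\geq j+\left\lfloor\frac{5k-3}{2}\right\rfloor. \]
   Context: $\pi_5(n)$ denotes the exponent of the highest power of $5$ dividing $n$, with $\pi_5(0)=+\infty$. The integers $m(i,j)$ ($i,j\geq1$) are defined by: $m(1,1)=5$, $m(2,1)=10$, $m(3,1)=9$, $m(4,1)=4$, $m(5,1)=1$, $m(i,1)=0$ for $i\geq6$; and for $j\geq2$, $i\geq1$, $m(i,j)=25m(i-1,j-1)+25m(i-2,j-1)+15m(i-3,j-1)+5m(i-4,j-1)+m(i-5,j-1)$, with $m(i',j')=0$ whenever $i'\leq0$. The integers $c(j,k)$ are defined by $c(1,1)=140$, $c(1,2)=49\cdot5^4$, $c(1,3)=21\cdot5^7$, $c(1,4)=91\cdot5^8$, $c(1,5)=7\cdot5^{11}$, $c(1,6)=5^{13}$, $c(1,k)=0$ for $k\geq7$, and $c(j+1,k)=\sum_{i\geq1}c(j,i)m(6i+6,i+k+1)$ if $j$ is odd, $c(j+1,k)=\sum_{i\geq1}c(j,i)m(6i+7,i+k+1)$ if $j$ is even. -}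

module Defs where

open import Data.Nat using (ℕ; zero; suc; _+_; _*_; _∸_; _^_; _/_)
open import Data.Nat.Divisibility using (_∣_)
open import Data.Bool using (Bool; true; false; if_then_else_)

m : ℕ → ℕ → ℕ
m zero _ = 0
m _ zero = 0
m 1 1 = 5
m 2 1 = 10
m 3 1 = 9
m 4 1 = 4
m 5 1 = 1
m (suc i) 1 = 0
m i (suc (suc j)) = 25 * m (i ∸ 1) (suc j) + 25 * m (i ∸ 2) (suc j)
                  + 15 * m (i ∸ 3) (suc j) + 5 * m (i ∸ 4) (suc j) + m (i ∸ 5) (suc j)
-- note: for i ≥ 1, i ∸ d = i - d when i > d, and i ∸ d = 0 (giving m = 0) when i - d ≤ 0,
-- so the truncated subtraction realises exactly the convention m(i',j') = 0 for i' ≤ 0.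

sum1 : ℕ → (ℕ → ℕ) → ℕ
sum1 zero f = 0
sum1 (suc n) f = sum1 n f + f (suc n)

-- S j : bound on the support of k ↦ c(j,k): c(j,k) = 0 for k > S j.
-- (S 1 = 6; if c(j,i) = 0 for i > s then c(j+1,k) = 0 for k > 5s+6, since
--  m(a,b) = 0 unless b ≤ a ≤ 5b.)  Hence the sum over i ≥ 1 equals the sum over 1 ≤ i ≤ S j.
S : ℕ → ℕ
S zero = 0
S (suc zero) = 6
S (suc (suc j)) = 5 * S (suc j) + 6

odd? : ℕ → Bool
odd? zero = false
odd? (suc zero) = true
odd? (suc (suc n)) = odd? n

-- c(j,k) for j ≥ 1, k ≥ 1 (value at j = 0 or k = 0 is an irrelevant dummy 0)
c : ℕ → ℕ → ℕ
c zero _ = 0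
c (suc zero) 1 = 140
c (suc zero) 2 = 49 * 5 ^ 4
c (suc zero) 3 = 21 * 5 ^ 7
c (suc zero) 4 = 91 * 5 ^ 8
c (suc zero) 5 = 7 * 5 ^ 11
c (suc zero) 6 = 5 ^ 13
c (suc zero) _ = 0
c (suc (suc j)) k =
  sum1 (S (suc j)) (λ i → c (suc j) i *
    m (6 * i + (if odd? (suc j) then 6 else 7)) (i + k + 1))

-- π₅(n) ≥ e  (with π₅(0) = +∞), i.e. 5^e divides n
π₅≥ : ℕ → ℕ → Set
π₅≥ n e = 5 ^ e ∣ n

-- Write the bounds as π₅(x) ≥ ⌊(t − s)/2⌋.  By induction on j, π₅(m(i,j)) ≥
-- ⌊(5j − i − 1)/2⌋: in the recurrence for m the coefficient of m(i − d, j − 1)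
-- has at least (5 − d)/2 factors of 5.  In the recurrence for c, if
-- π₅(c(j,i)) ≥ a + 2(i − 1) then every term c(j,i)·m(6i + r, i + k + 1) has
-- π₅ ≥ ⌊(2a + 5k + 3 − r)/2⌋, independently of i; with r = 6 for odd j and r = 7
-- for even j this carries the bound for c(2n+1, ·) to c(2n+2, ·) and back.
module Submission where

open import Defs
open import Data.Nat using (ℕ; zero; suc; _+_; _*_; _∸_; _^_; _/_; _≤_; _<_; _≥_; z≤n; s≤s; _≤?_)
open import Data.Nat.Properties
open import Data.Nat.Divisibility
open import Data.Nat.DivMod using (m/n*n≤m)
open import Data.Nat.Tactic.RingSolver using (solve)
open import Data.Bool using (true; false; if_then_else_)
open import Data.List using ([]; _∷_)
open import Data.Product using (_×_; _,_)
open import Relation.Nullary using (yes; no)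
open import Relation.Binary.PropositionalEquality

^-monoʳ-∣ : ∀ p {e f} → e ≤ f → p ^ e ∣ p ^ f
^-monoʳ-∣ p {e} {f} e≤f =
  subst (λ g → p ^ e ∣ p ^ g) (m+[n∸m]≡n e≤f)
    (subst (p ^ e ∣_) (sym (^-distribˡ-+-* p e (f ∸ e))) (m∣m*n (p ^ (f ∸ e))))

m+k≡n⇒m≤n : ∀ {m n} k → m + k ≡ n → m ≤ n
m+k≡n⇒m≤n k refl = m≤m+n _ k

2*m≤1+2*n⇒m≤n : ∀ {m n} → 2 * m ≤ suc (2 * n) → m ≤ n
2*m≤1+2*n⇒m≤n {m} {n} le =
  m<1+n⇒m≤n (*-cancelˡ-< 2 m (suc n) (subst (2 * m <_) (sym (*-suc 2 n)) (s≤s le)))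

module HalfPowers (p : ℕ) where

  -- p ^ ⌊(t ∸ s)/2⌋ ∣ x, with the two ends of the exponent kept apart so that no
  -- truncated subtraction or division enters the bookkeeping.
  record HalfPow∣ (s t x : ℕ) : Set where
    constructor halfPow∣
    field
      pow∣ : ∀ e → 2 * e + s ≤ t → p ^ e ∣ x

  open HalfPow∣ public

  halfPow∣-0 : ∀ {s t} → HalfPow∣ s t 0
  halfPow∣-0 = halfPow∣ λ e _ → (p ^ e) ∣0

  halfPow∣-+ : ∀ {s t x y} → HalfPow∣ s t x → HalfPow∣ s t y → HalfPow∣ s t (x + y)
  halfPow∣-+ (halfPow∣ hx) (halfPow∣ hy) = halfPow∣ λ e le → ∣m∣n⇒∣m+n (hx e le) (hy e le)

  halfPow∣-sum1 : ∀ {s t} n f → (∀ i → HalfPow∣ s t (f (suc i))) → HalfPow∣ s t (sum1 n f)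
  halfPow∣-sum1 zero    f hf = halfPow∣-0
  halfPow∣-sum1 (suc n) f hf = halfPow∣-+ (halfPow∣-sum1 n f hf) (hf n)

  halfPow∣-weaken : ∀ {s t s′ t′ x} → HalfPow∣ s t x → t′ + s ≤ t + s′ → HalfPow∣ s′ t′ x
  halfPow∣-weaken {s} {t} {s′} {t′} (halfPow∣ hx) le =
    halfPow∣ λ e le′ → hx e (+-cancelʳ-≤ s′ (2 * e + s) t (begin
    2 * e + s + s′   ≡⟨ +-assoc (2 * e) s s′ ⟩
    2 * e + (s + s′) ≡⟨ cong (2 * e +_) (+-comm s s′) ⟩
    2 * e + (s′ + s) ≡⟨ +-assoc (2 * e) s′ s ⟨
    2 * e + s′ + s   ≤⟨ +-monoˡ-≤ s le′ ⟩
    t′ + s           ≤⟨ le ⟩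
    t + s′           ∎))
    where open ≤-Reasoning

  halfPow∣-*ˡ : ∀ {h s t x y} → p ^ h ∣ x → HalfPow∣ s t y → HalfPow∣ s (t + 2 * h) (x * y)
  halfPow∣-*ˡ {h} {s} {t} {x} {y} hx (halfPow∣ hy) = halfPow∣ pow∣-xy
    where
    pow∣-xy : ∀ e → 2 * e + s ≤ t + 2 * h → p ^ e ∣ x * y
    pow∣-xy e le with e ≤? h
    ... | yes e≤h = ∣-trans (^-monoʳ-∣ p e≤h) (∣m⇒∣m*n y hx)
    ... | no  e≰h = subst (λ g → p ^ g ∣ x * y) h+d≡e
                      (subst (_∣ x * y) (sym (^-distribˡ-+-* p h d)) (*-pres-∣ hx (hy d 2d+s≤t)))
      where
      d = e ∸ h
      h+d≡e : h + d ≡ e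
      h+d≡e = m+[n∸m]≡n (<⇒≤ (≰⇒> e≰h))
      2d+s≤t : 2 * d + s ≤ t
      2d+s≤t = +-cancelʳ-≤ (2 * h) (2 * d + s) t (begin
        2 * d + s + 2 * h ≡⟨ rearrange h d s ⟩
        2 * (h + d) + s   ≡⟨ cong (λ g → 2 * g + s) h+d≡e ⟩
        2 * e + s         ≤⟨ le ⟩
        t + 2 * h         ∎)
        where
        open ≤-Reasoning
        rearrange : ∀ h d s → 2 * d + s + 2 * h ≡ 2 * (h + d) + s
        rearrange h d s = solve (h ∷ d ∷ s ∷ [])

  pow∣⇒halfPow∣ : ∀ {f s t x} → t ≤ suc (2 * f) + s → p ^ f ∣ x → HalfPow∣ s t x
  pow∣⇒halfPow∣ {f} {s} t≤ hx = halfPow∣ λ e le → ∣-trans (^-monoʳ-∣ p (e≤f e (≤-trans le t≤))) hx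
    where
    e≤f : ∀ e → 2 * e + s ≤ suc (2 * f) + s → e ≤ f
    e≤f e le = 2*m≤1+2*n⇒m≤n (+-cancelʳ-≤ s (2 * e) (suc (2 * f)) le)

  halfPow∣-trivial : ∀ {s t x} → t ≤ suc s → HalfPow∣ s t x
  halfPow∣-trivial t≤ = pow∣⇒halfPow∣ {f = 0} t≤ (1∣ _)

  halfPow∣⇒pow∣-floor : ∀ a t {x} → HalfPow∣ 0 (2 * a + t) x → p ^ (a + t / 2) ∣ x
  halfPow∣⇒pow∣-floor a t (halfPow∣ hx) = hx (a + t / 2) (begin
    2 * (a + t / 2) + 0   ≡⟨ +-identityʳ _ ⟩
    2 * (a + t / 2)       ≡⟨ *-distribˡ-+ 2 a (t / 2) ⟩
    2 * a + 2 * (t / 2)   ≤⟨ +-monoʳ-≤ (2 * a) (subst (_≤ t) (*-comm (t / 2) 2) (m/n*n≤m t 2)) ⟩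
    2 * a + t             ∎)
    where open ≤-Reasoning

open HalfPowers 5

m-recurrence : ∀ i j → m (suc i) (suc (suc j)) ≡
  25 * m i (suc j) + 25 * m (i ∸ 1) (suc j) + 15 * m (i ∸ 2) (suc j)
    + 5 * m (i ∸ 3) (suc j) + m (i ∸ 4) (suc j)
m-recurrence 0 j = refl
m-recurrence 1 j = refl
m-recurrence 2 j = refl
m-recurrence 3 j = refl
m-recurrence 4 j = refl
m-recurrence (suc (suc (suc (suc (suc i))))) j = refl

MBound : ℕ → Set
MBound j = ∀ i → HalfPow∣ (i + 1) (5 * j) (m i j)

m-bound-shift : ∀ {j} I d → MBound j → HalfPow∣ (I + 1) (5 * j + d) (m (I ∸ d) j)
m-bound-shift {j} I d ih with d ≤? I
... | yes d≤I = halfPow∣-weaken (ih (I ∸ d)) (≤-reflexive (begin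
  5 * j + d + (I ∸ d + 1) ≡⟨ rearrange (5 * j) (I ∸ d) d ⟩
  5 * j + (I ∸ d + d + 1) ≡⟨ cong (λ i → 5 * j + (i + 1)) (m∸n+n≡m d≤I) ⟩
  5 * j + (I + 1)         ∎))
  where
  open ≡-Reasoning
  rearrange : ∀ x y z → x + z + (y + 1) ≡ x + (y + z + 1)
  rearrange x y z = solve (x ∷ y ∷ z ∷ [])
... | no d≰I = subst (λ i → HalfPow∣ (I + 1) (5 * j + d) (m i j))
                 (sym (m≤n⇒m∸n≡0 (<⇒≤ (≰⇒> d≰I)))) halfPow∣-0

-- Moving from column j to j + 1 demands 5 more half-units of exponent: the
-- shift of the row by d supplies d of them, the factor 5 ^ h of a the other 2h.
m-bound-term : ∀ {a h j} I d → 5 ^ h ∣ a → 5 ≤ d + 2 * h → MBound j →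
  HalfPow∣ (I + 1) (5 * suc j) (a * m (I ∸ d) j)
m-bound-term {h = h} {j = j} I d 5^h∣a 5≤d+2h ih =
  halfPow∣-weaken (halfPow∣-*ˡ {h = h} 5^h∣a (m-bound-shift I d ih)) (+-monoˡ-≤ (I + 1) (begin
    5 * suc j           ≡⟨ *-suc 5 j ⟩
    5 + 5 * j           ≡⟨ +-comm 5 (5 * j) ⟩
    5 * j + 5           ≤⟨ +-monoʳ-≤ (5 * j) 5≤d+2h ⟩
    5 * j + (d + 2 * h) ≡⟨ +-assoc (5 * j) d (2 * h) ⟨
    5 * j + d + 2 * h   ∎))
  where open ≤-Reasoning

m-bound-1 : MBound 1
m-bound-1 zero = halfPow∣-0
m-bound-1 1 = pow∣⇒halfPow∣ {f = 1} ≤-refl ∣-refl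
m-bound-1 2 = pow∣⇒halfPow∣ {f = 1} (n≤1+n 5) (divides 2 refl)
m-bound-1 (suc (suc (suc i))) = halfPow∣-trivial (s≤s (s≤s (s≤s (s≤s (m≤n+m 1 i)))))

m-bound-suc : ∀ {j} → MBound (suc j) → MBound (suc (suc j))
m-bound-suc     ih zero    = halfPow∣-0
m-bound-suc {j} ih (suc i) =
  subst (HalfPow∣ (I + 1) (5 * suc (suc j))) (sym (m-recurrence i j))
    (halfPow∣-+ (halfPow∣-+ (halfPow∣-+ (halfPow∣-+
      (m-bound-term {h = 2} I 1 (divides 1 refl) ≤-refl ih)
      (m-bound-term {h = 2} I 2 (divides 1 refl) (n≤1+n 5) ih))
      (m-bound-term {h = 1} I 3 (divides 3 refl) ≤-refl ih))
      (m-bound-term {h = 1} I 4 (divides 1 refl) (n≤1+n 5) ih))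
      (subst (HalfPow∣ (I + 1) (5 * suc (suc j))) (*-identityˡ _)
        (m-bound-term {h = 0} I 5 (1∣ 1) ≤-refl ih)))
  where
  I = suc i

m-bound : ∀ j → MBound j
m-bound zero        i = halfPow∣-trivial z≤n
m-bound (suc zero)    = m-bound-1
m-bound (suc (suc j)) = m-bound-suc (m-bound (suc j))

-- Per unit of i a term gains 4 half-units from f and 5 from the column of m but
-- loses only 6 to the row of m, so the term i = 1 is the worst.
sum-mul-m-bound : ∀ N (f : ℕ → ℕ) r a k → (∀ i → 5 ^ (a + 2 * i) ∣ f (suc i)) →
  HalfPow∣ r (2 * a + 5 * k + 8) (sum1 N (λ i → f i * m (6 * i + r) (i + suc k + 1)))
sum-mul-m-bound N f r a k hf = halfPow∣-sum1 N term term-bound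
  where
  term : ℕ → ℕ
  term i = f i * m (6 * i + r) (i + suc k + 1)
  term-bound : ∀ i → HalfPow∣ r (2 * a + 5 * k + 8) (term (suc i))
  term-bound i =
    halfPow∣-weaken (halfPow∣-*ˡ {h = a + 2 * i} (hf i) (m-bound (suc i + suc k + 1) (6 * suc i + r)))
      (m+k≡n⇒m≤n (3 * i) (solve (a ∷ k ∷ r ∷ i ∷ [])))

odd?-double : ∀ n → odd? (2 * n) ≡ false
odd?-double zero    = refl
odd?-double (suc n) = trans (cong odd? (*-suc 2 n)) (odd?-double n)

odd?-suc-double : ∀ n → odd? (suc (2 * n)) ≡ true
odd?-suc-double zero    = refl
odd?-suc-double (suc n) = trans (cong (λ x → odd? (suc x)) (*-suc 2 n)) (odd?-suc-double n)

c-suc-bound : ∀ j a k {b} → odd? (suc j) ≡ b → (∀ i → 5 ^ (a + 2 * i) ∣ c (suc j) (suc i)) →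
  HalfPow∣ (if b then 6 else 7) (2 * a + 5 * k + 8) (c (suc (suc j)) (suc k))
c-suc-bound j a k refl hc = sum-mul-m-bound (S (suc j)) (c (suc j)) (if odd? (suc j) then 6 else 7) a k hc

c-odd-bound : ∀ n k → HalfPow∣ 0 (2 * suc n + 5 * k) (c (suc (2 * n)) (suc k))
c-even-bound : ∀ n k → HalfPow∣ 0 (2 * suc n + (2 + 5 * k)) (c (suc (suc (2 * n))) (suc k))

c-odd-bound zero 0 = pow∣⇒halfPow∣ {f = 1} (≤ᵇ⇒≤ _ _ _) (divides 28 refl)
c-odd-bound zero 1 = pow∣⇒halfPow∣ {f = 4} (≤ᵇ⇒≤ _ _ _) (n∣m*n 49)
c-odd-bound zero 2 = pow∣⇒halfPow∣ {f = 7} (≤ᵇ⇒≤ _ _ _) (n∣m*n 21)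
c-odd-bound zero 3 = pow∣⇒halfPow∣ {f = 8} (≤ᵇ⇒≤ _ _ _) (n∣m*n 91)
c-odd-bound zero 4 = pow∣⇒halfPow∣ {f = 11} (≤ᵇ⇒≤ _ _ _) (n∣m*n 7)
c-odd-bound zero 5 = pow∣⇒halfPow∣ {f = 13} (≤ᵇ⇒≤ _ _ _) ∣-refl
c-odd-bound zero (suc (suc (suc (suc (suc (suc k)))))) = halfPow∣-0
c-odd-bound (suc n) k =
  subst (λ j → HalfPow∣ 0 (2 * suc (suc n) + 5 * k) (c (suc j) (suc k))) (sym (*-suc 2 n))
    (halfPow∣-weaken
      (c-suc-bound (suc (2 * n)) (suc (suc n)) k (odd?-double n) λ i →
        pow∣ (c-even-bound n i) (suc (suc n) + 2 * i) (m+k≡n⇒m≤n i (solve (n ∷ i ∷ []))))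
      (m+k≡n⇒m≤n 1 (solve (n ∷ k ∷ []))))

c-even-bound n k =
  halfPow∣-weaken
    (c-suc-bound (2 * n) (suc n) k (odd?-suc-double n) λ i →
      pow∣ (c-odd-bound n i) (suc n + 2 * i) (m+k≡n⇒m≤n i (solve (n ∷ i ∷ []))))
    (≤-reflexive (solve (n ∷ k ∷ [])))

lemma4p7 : (j k : ℕ) → j ≥ 1 → k ≥ 1 →
    π₅≥ (c (2 * j ∸ 1) k) (j + (5 * k ∸ 5) / 2)
      × π₅≥ (c (2 * j) k) (j + (5 * k ∸ 3) / 2)
lemma4p7 (suc n) (suc k) _ _ =
  subst₂ (λ j e → π₅≥ (c j (suc k)) (suc n + e / 2))
    (cong (_∸ 1) (sym (*-suc 2 n))) (cong (_∸ 5) (sym (*-suc 5 k)))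
    (halfPow∣⇒pow∣-floor (suc n) (5 * k) (c-odd-bound n k))
  , subst₂ (λ j e → π₅≥ (c j (suc k)) (suc n + e / 2))
      (sym (*-suc 2 n)) (cong (_∸ 3) (sym (*-suc 5 k)))
      (halfPow∣⇒pow∣-floor (suc n) (2 + 5 * k) (c-even-bound n k))
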